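{- Let $G$ be a graph, $T$ a rooted tree, $\mathrm{map}\colon V(T)\to V(G)$ a valid mapping, and $a,L\in\mathbb N$. Let $\ell_T$ be the output of $\mathrm{PartialLayerAssignmentTree}(G,T,\mathrm{map},a,L)$ and define $\ell\colon V(G)\to[L]\cup\{\infty\}$ by $\ell(v)=\min\{\ell_T(x):x\in V(T),\mathrm{map}(x)=v\}$, with $\ell(v)=\infty$ if no node maps to $v$. Then for every $v\in V(G)$ with $\ell(v)\ne\infty$, $|\{u\in N_G(v):\ell(u)\ge\ell(v)\}|\le a$.
   Context: $[L]=\{1,\dots,L\}$, $\infty$ exceeds every integer. A mapping $\mathrm{map}\colon V(T)\to V(G)$ is valid if every tree edge $(x,y)$ maps to an edge of $G$ and distinct children of the same node have distinct images. $\mathrm{Missing}(x)=N_G(\mathrm{map}(x))\setminus\{\mathrm{map}(c):c\text{ child of }x\}$. $\mathrm{PartialLayerAssignmentTree}(G,T,\mathrm{map},a,L)$: $V_{\ge1}=V(T)$; for $j=1,\dots,L$: $V_j=\{x\in V_{\ge j}:|\mathrm{children}_T(x)\cap V_{\ge j}|+|\mathrm{Missing}(x)|\le a\}$, $\ell_T(x)=j$ for $x\in V_j$, $V_{\ge j+1}=V_{\ge j}\setminus V_j$; finally $\ell_T(x)=\infty$ on $V_{\ge L+1}$. -}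

module Defs where

open import Data.Nat using (ℕ; zero; suc; _+_; _≤_; _≤ᵇ_)
open import Data.Bool using (Bool; true; false; _∧_; not; if_then_else_)
open import Data.Fin using (Fin; _≟_)
open import Data.List using (List; foldr)
open import Data.Bool.ListAction using (any)
open import Data.List.Base using ()
open import Data.Fin.Base using ()
open import Data.Maybe using (Maybe; just; nothing)
open import Data.Product using (∃)
open import Relation.Nullary.Decidable using (⌊_⌋)
open import Relation.Binary.PropositionalEquality using (_≡_)
open import Data.List using (allFin) public

record Graph (n : ℕ) : Set where
  field
    adj     : Fin n → Fin n → Bool
    adj-sym : ∀ u v → adj u v ≡ adj v u
    irrefl  : ∀ v → adj v v ≡ false
open Graph public

ancestor : ∀ {m} → (Fin m → Maybe (Fin m)) → ℕ → Fin m → Maybe (Fin m)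
ancestor p zero    x = just x
ancestor p (suc k) x with ancestor p k x
... | nothing = nothing
... | just y  = p y

record RootedTree (m : ℕ) : Set where
  field
    root        : Fin m
    parent      : Fin m → Maybe (Fin m)
    root-parent : parent root ≡ nothing
    only-root   : ∀ x → parent x ≡ nothing → x ≡ root
    reaches-root : ∀ x → ∃ λ k → ancestor parent k x ≡ just root
open RootedTree public

isChild : ∀ {m} → RootedTree m → Fin m → Fin m → Bool
isChild T x c with parent T c
... | nothing = false
... | just y  = ⌊ y ≟ x ⌋

record ValidMap {n m} (G : Graph n) (T : RootedTree m) (mp : Fin m → Fin n) : Set where
  field
    edge     : ∀ x y → parent T x ≡ just y → adj G (mp x) (mp y) ≡ true
    childInj : ∀ x c c' → isChild T x c ≡ true → isChild T x c' ≡ true →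
               mp c ≡ mp c' → c ≡ c'

count : ∀ {k} → (Fin k → Bool) → ℕ
count {k} P = foldr (λ i acc → if P i then suc acc else acc) 0 (allFin k)

data ℕ∞ : Set where
  fin : ℕ → ℕ∞
  ∞   : ℕ∞

_≤∞ᵇ_ : ℕ∞ → ℕ∞ → Bool
fin x ≤∞ᵇ fin y = x ≤ᵇ y
fin x ≤∞ᵇ ∞     = true
∞     ≤∞ᵇ fin y = false
∞     ≤∞ᵇ ∞     = true

min∞ : ℕ∞ → ℕ∞ → ℕ∞
min∞ x y = if x ≤∞ᵇ y then x else y

module Layering {n m} (G : Graph n) (T : RootedTree m) (mp : Fin m → Fin n)
                (a L : ℕ) where

  missing : Fin m → Fin n → Bool
  missing x v = adj G (mp x) v ∧ not (any (λ c → isChild T x c ∧ ⌊ mp c ≟ v ⌋) (allFin m))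

  mutual
    -- geq j x  ⇔  x ∈ V_{≥ j+1}
    geq : ℕ → Fin m → Bool
    geq zero    x = true
    geq (suc j) x = geq j x ∧ not (peel j x)

    -- peel j x  ⇔  x ∈ V_{j+1}
    peel : ℕ → Fin m → Bool
    peel j x = geq j x ∧
      ((count (λ c → isChild T x c ∧ geq j c) + count (missing x)) ≤ᵇ a)

  -- search rounds j+1, …, j+f
  search : ℕ → ℕ → Fin m → ℕ∞
  search j zero    x = ∞
  search j (suc f) x = if peel j x then fin (suc j) else search (suc j) f x

  ℓT : Fin m → ℕ∞
  ℓT x = search 0 L x

  ℓ : Fin n → ℕ∞
  ℓ v = foldr (λ x acc → if ⌊ mp x ≟ v ⌋ then min∞ (ℓT x) acc else acc) ∞ (allFin m)

{-# OPTIONS --safe #-}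
-- Let x be a node realising ℓ(v) = j + 1, so x is peeled in round j + 1.  A neighbour u of v
-- with ℓ(u) ≥ j + 1 lies in Missing(x) or is the image of a child c of x; then
-- ℓ_T(c) ≥ ℓ(u) ≥ j + 1, and since a node removed in an earlier round receives that earlier
-- layer, c is still in V_{≥ j+1}.  So such u are at most |Missing(x)| plus the number of
-- children of x in V_{≥ j+1}, which the peeling rule bounds by a.
module Submission where

open import Defs
open import Data.Bool using (Bool; true; false; _∧_; not; if_then_else_; T)
open import Data.Bool.ListAction using (any)
open import Data.Bool.Properties using (T-∧)
open import Data.Empty using (⊥-elim)
open import Data.Fin using (Fin; zero; suc; _≟_)
open import Data.Fin.Properties using (suc-injective)
open import Data.List using (List; []; _∷_; foldr; map; tabulate)
open import Data.List.Membership.Propositional using (_∈_)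
open import Data.List.Membership.Propositional.Properties using (∈-allFin)
open import Data.List.Properties using (foldr-map; map-tabulate)
open import Data.List.Relation.Unary.Any using (here; there; satisfied)
open import Data.List.Relation.Unary.Any.Properties using (any⁻)
open import Data.Nat using (ℕ; zero; suc; _+_; _≤_; _<_; z≤n; s≤s; s≤s⁻¹)
open import Data.Nat.Properties
  using (≤-refl; ≤-trans; ≤-reflexive; n≤1+n; +-suc; +-comm; +-mono-≤; +-monoʳ-≤; +-identityʳ;
         ≤ᵇ⇒≤; ≤⇒≤ᵇ; ≰⇒≥; <⇒≱; ≤∧≢⇒<; <-trans; m<m+n; m<n⇒m<1+n; n<1+n;
         module ≤-Reasoning)
open import Data.Product using (∃; ∃₂; _×_; _,_; proj₂)
open import Data.Sum using (_⊎_; inj₁; inj₂)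
open import Function using (_∘_; _$_; case_of_)
open import Function.Bundles using (Equivalence)
open import Relation.Binary.PropositionalEquality
  using (_≡_; _≢_; refl; sym; cong; subst; module ≡-Reasoning)
open import Relation.Nullary using (¬_; yes; no)
open import Relation.Nullary.Decidable using (⌊_⌋; T?; toWitness; fromWitness; toWitnessFalse)

open Equivalence using (to; from)

count-suc : ∀ {k} (P : Fin (suc k) → Bool) →
  count P ≡ (if P zero then suc (count (P ∘ suc)) else count (P ∘ suc))
count-suc {k} P = cong (tally zero) $ begin
  foldr tally 0 (tabulate Data.Fin.suc)
    ≡⟨ cong (foldr tally 0) (sym (map-tabulate (λ i → i) Data.Fin.suc)) ⟩
  foldr tally 0 (map Data.Fin.suc (allFin k))
    ≡⟨ foldr-map tally Data.Fin.suc 0 (allFin k) ⟩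
  count (P ∘ suc)
    ∎
  where
  open ≡-Reasoning
  tally : Fin (suc k) → ℕ → ℕ
  tally i c = if P i then suc c else c

≤-if-suc : ∀ b c → c ≤ (if b then suc c else c)
≤-if-suc true  c = n≤1+n c
≤-if-suc false c = ≤-refl

count-empty : ∀ {k} {P : Fin k → Bool} → (∀ u → ¬ T (P u)) → count P ≡ 0
count-empty {zero}      none = refl
count-empty {suc k} {P} none rewrite count-suc P with P zero | none zero
... | false | _   = count-empty (none ∘ suc)
... | true  | ¬pz = ⊥-elim (¬pz _)

count-≤-∪ : ∀ {k} {P Q R : Fin k → Bool} →
  (∀ u → T (P u) → T (Q u) ⊎ T (R u)) → count P ≤ count Q + count R
count-≤-∪ {zero}              cover = z≤n
count-≤-∪ {suc k} {P} {Q} {R} cover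
  rewrite count-suc P | count-suc Q | count-suc R
  with P zero | Q zero | R zero | cover zero | count-≤-∪ (cover ∘ suc)
... | false | q     | r     | _   | ih = ≤-trans ih (+-mono-≤ (≤-if-suc q _) (≤-if-suc r _))
... | true  | true  | r     | _   | ih = s≤s (≤-trans ih (+-monoʳ-≤ _ (≤-if-suc r _)))
... | true  | false | true  | _   | ih = ≤-trans (s≤s ih) (≤-reflexive (sym (+-suc _ _)))
... | true  | false | false | cz  | _  = case cz _ of λ { (inj₁ ()) ; (inj₂ ()) }

count-mono : ∀ {k} {P Q : Fin k → Bool} → (∀ u → T (P u) → T (Q u)) → count P ≤ count Q
count-mono {k} {P} {Q} P⊆Q = begin
  count P                                 ≤⟨ count-≤-∪ {R = λ _ → false} (λ u → inj₁ ∘ P⊆Q u) ⟩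
  count Q + count (λ (_ : Fin k) → false) ≡⟨ cong (count Q +_) (count-empty {k} (λ _ ())) ⟩
  count Q + 0                             ≡⟨ +-identityʳ (count Q) ⟩
  count Q                                 ∎
  where open ≤-Reasoning

count-singleton : ∀ {k} (w : Fin k) → count (λ u → ⌊ w ≟ u ⌋) ≤ 1
count-singleton {suc k} zero    rewrite count-suc (λ u → ⌊ zero {k} ≟ u ⌋) =
  ≤-reflexive (cong suc (count-empty {P = λ (_ : Fin k) → false} (λ _ ())))
count-singleton {suc k} (suc w) rewrite count-suc (λ u → ⌊ suc w ≟ u ⌋) =
  ≤-trans (count-mono {Q = λ u → ⌊ w ≟ u ⌋} (λ _ → fromWitness ∘ suc-injective ∘ toWitness))
          (count-singleton w)

∃-tail : ∀ {m} {Q : Fin (suc m) → Set} → ∃ Q → ¬ Q zero → ∃ (Q ∘ suc)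
∃-tail (zero  , q) ¬q0 = ⊥-elim (¬q0 q)
∃-tail (suc c , q) _   = c , q

count-image : ∀ {k m} (f : Fin m → Fin k) {P : Fin k → Bool} {R : Fin m → Bool} →
  (∀ u → T (P u) → ∃ λ c → T (R c) × f c ≡ u) → count P ≤ count R
count-image {m = zero}  f cover = ≤-reflexive (count-empty λ u pu → case cover u pu of λ ())
count-image {k} {suc m} f {P} {R} cover rewrite count-suc R with R zero in R0
... | false = count-image (f ∘ suc) λ u pu →
                ∃-tail (cover u pu) λ (rz , _) → case subst T R0 rz of λ ()
... | true  = ≤-trans (count-≤-∪ {Q = λ u → ⌊ f zero ≟ u ⌋} {R = P′} split)
                      (+-mono-≤ (count-singleton (f zero)) (count-image (f ∘ suc) cover′))
  where
  P′ : Fin k → Bool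
  P′ u = P u ∧ not ⌊ f zero ≟ u ⌋
  split : ∀ u → T (P u) → T ⌊ f zero ≟ u ⌋ ⊎ T (P′ u)
  split u pu with f zero ≟ u
  ... | yes _ = inj₁ _
  ... | no  _ = inj₂ (from T-∧ (pu , _))
  cover′ : ∀ u → T (P′ u) → ∃ λ c → T (R (suc c)) × f (suc c) ≡ u
  cover′ u p′ with to T-∧ p′
  ... | pu , f0≢u = ∃-tail (cover u pu) λ (_ , f0≡u) → toWitnessFalse f0≢u f0≡u

count-≤-count+image : ∀ {k m} (f : Fin m → Fin k) {P Q : Fin k → Bool} {R : Fin m → Bool} →
  (∀ u → T (P u) → T (Q u) ⊎ ∃ λ c → T (R c) × f c ≡ u) → count P ≤ count Q + count R
count-≤-count+image f {P} {Q} {R} cover =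
  ≤-trans (count-≤-∪ {R = λ u → P u ∧ not (Q u)} split) (+-monoʳ-≤ (count Q) (count-image f image))
  where
  split : ∀ u → T (P u) → T (Q u) ⊎ T (P u ∧ not (Q u))
  split u pu with Q u
  ... | true  = inj₁ _
  ... | false = inj₂ (from T-∧ (pu , _))
  image : ∀ u → T (P u ∧ not (Q u)) → ∃ λ c → T (R c) × f c ≡ u
  image u pu∧¬qu with to T-∧ pu∧¬qu
  ... | pu , ¬qu with Q u | cover u pu
  ...   | true  | _          = ⊥-elim ¬qu
  ...   | false | inj₂ found = found

≤∞ᵇ-refl : ∀ x → T (x ≤∞ᵇ x)
≤∞ᵇ-refl (fin x) = ≤⇒≤ᵇ (≤-refl {x})
≤∞ᵇ-refl ∞       = _

≤∞ᵇ-trans : ∀ x y z → T (x ≤∞ᵇ y) → T (y ≤∞ᵇ z) → T (x ≤∞ᵇ z)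
≤∞ᵇ-trans (fin x) (fin y) (fin z) x≤y y≤z = ≤⇒≤ᵇ (≤-trans (≤ᵇ⇒≤ x y x≤y) (≤ᵇ⇒≤ y z y≤z))
≤∞ᵇ-trans (fin x) y       ∞       _   _   = _
≤∞ᵇ-trans ∞       ∞       ∞       _   _   = _
≤∞ᵇ-trans (fin x) ∞       (fin z) _   ()
≤∞ᵇ-trans ∞       (fin y) z       ()  _
≤∞ᵇ-trans ∞       ∞       (fin z) _   ()

≤∞ᵇ-total : ∀ x y → ¬ T (x ≤∞ᵇ y) → T (y ≤∞ᵇ x)
≤∞ᵇ-total (fin x) (fin y) x≰y = ≤⇒≤ᵇ (≰⇒≥ (x≰y ∘ ≤⇒≤ᵇ {x} {y}))
≤∞ᵇ-total (fin x) ∞       x≰y = ⊥-elim (x≰y _)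
≤∞ᵇ-total ∞       (fin y) _   = _
≤∞ᵇ-total ∞       ∞       _   = _

min∞-≤ˡ : ∀ x y → T (min∞ x y ≤∞ᵇ x)
min∞-≤ˡ x y with x ≤∞ᵇ y in x≤y
... | true  = ≤∞ᵇ-refl x
... | false = ≤∞ᵇ-total x y (subst T x≤y)

min∞-≤ʳ : ∀ x y → T (min∞ x y ≤∞ᵇ y)
min∞-≤ʳ x y with x ≤∞ᵇ y in x≤y
... | true  = subst T (sym x≤y) _
... | false = ≤∞ᵇ-refl y

-- Layering.ℓ v unfolds to minWhere (λ x → ⌊ mp x ≟ v ⌋) ℓT (allFin m).
minWhere : ∀ {A : Set} → (A → Bool) → (A → ℕ∞) → List A → ℕ∞
minWhere p g = foldr (λ x acc → if p x then min∞ (g x) acc else acc) ∞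

module _ {A : Set} (p : A → Bool) (g : A → ℕ∞) where

  minWhere-≤ : ∀ {x xs} → x ∈ xs → T (p x) → T (minWhere p g xs ≤∞ᵇ g x)
  minWhere-≤ {x} {y ∷ xs} (here refl) px with p y
  ... | true  = min∞-≤ˡ (g y) (minWhere p g xs)
  ... | false = ⊥-elim px
  minWhere-≤ {x} {y ∷ xs} (there x∈xs) px with p y
  ... | true  = ≤∞ᵇ-trans (min∞ (g y) (minWhere p g xs)) _ (g x)
                  (min∞-≤ʳ (g y) (minWhere p g xs)) (minWhere-≤ x∈xs px)
  ... | false = minWhere-≤ x∈xs px

  minWhere-attained : ∀ xs → minWhere p g xs ≢ ∞ → ∃ λ x → T (p x) × minWhere p g xs ≡ g x
  minWhere-attained []       ≢∞ = ⊥-elim (≢∞ refl)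
  minWhere-attained (x ∷ xs) ≢∞ with p x in px
  ... | false = minWhere-attained xs ≢∞
  ... | true with g x ≤∞ᵇ minWhere p g xs
  ...   | true  = x , subst T (sym px) _ , refl
  ...   | false = minWhere-attained xs ≢∞

module Peeling {n m} (G : Graph n) (tree : RootedTree m) (mp : Fin m → Fin n) (a L : ℕ) where
  open Layering G tree mp a L

  search-≤-peel : ∀ s f {i x} → s ≤ i → i < s + f → T (peel i x) → T (search s f x ≤∞ᵇ fin (suc i))
  search-≤-peel s zero    s≤i i<s+0 _ = ⊥-elim (<⇒≱ (subst (_ <_) (+-identityʳ s) i<s+0) s≤i)
  search-≤-peel s (suc f) {i} {x} s≤i i<s+1+f peel-i with peel s x in peel-s
  ... | true  = ≤⇒≤ᵇ (s≤s s≤i)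
  ... | false = search-≤-peel (suc s) f (≤∧≢⇒< s≤i s≢i) (subst (i <_) (+-suc s f) i<s+1+f) peel-i
    where
    s≢i : s ≢ i
    s≢i refl = subst T peel-s peel-i

  search-fin : ∀ s f {x k} → search s f x ≡ fin k → ∃ λ i → k ≡ suc i × i < s + f × T (peel i x)
  search-fin s (suc f) {x} found with peel s x in peel-s
  search-fin s (suc f) refl | true  = s , refl , m<m+n s (s≤s z≤n) , subst T (sym peel-s) _
  search-fin s (suc f) found | false with search-fin (suc s) f found
  ... | i , refl , i<1+s+f , peel-i = i , refl , subst (i <_) (sym (+-suc s f)) i<1+s+f , peel-i

  peeled-before : ∀ j {x} → ¬ T (geq j x) → ∃ λ i → i < j × T (peel i x)
  peeled-before zero    ¬g = ⊥-elim (¬g _)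
  peeled-before (suc j) {x} ¬g with T? (geq j x)
  ... | no ¬gj with peeled-before j ¬gj
  ...   | i , i<j , peel-i = i , m<n⇒m<1+n i<j , peel-i
  peeled-before (suc j) {x} ¬g | yes gj with peel j x in peel-j
  ...   | true  = j , n<1+n j , subst T (sym peel-j) _
  ...   | false = ⊥-elim (¬g (from T-∧ (gj , _)))

  ℓT-≤-peel : ∀ {i x} → i < L → T (peel i x) → T (ℓT x ≤∞ᵇ fin (suc i))
  ℓT-≤-peel = search-≤-peel 0 L z≤n

  ≤ℓT⇒geq : ∀ {j c} → j < L → T (fin (suc j) ≤∞ᵇ ℓT c) → T (geq j c)
  ≤ℓT⇒geq {j} {c} j<L late with T? (geq j c)
  ... | yes g  = g
  ... | no ¬g with peeled-before j ¬g
  ...   | i , i<j , peel-i = ⊥-elim (<⇒≱ i<j (s≤s⁻¹ (≤ᵇ⇒≤ (suc j) (suc i) j+1≤i+1)))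
    where
    j+1≤i+1 : T (fin (suc j) ≤∞ᵇ fin (suc i))
    j+1≤i+1 = ≤∞ᵇ-trans (fin (suc j)) (ℓT c) (fin (suc i))
                late (ℓT-≤-peel (<-trans i<j j<L) peel-i)

  ℓ-≤-ℓT : ∀ {x v} → mp x ≡ v → T (ℓ v ≤∞ᵇ ℓT x)
  ℓ-≤-ℓT {x} {v} mx≡v = minWhere-≤ (λ y → ⌊ mp y ≟ v ⌋) ℓT (∈-allFin x) (fromWitness mx≡v)

  ℓ-witness : ∀ v → ℓ v ≢ ∞ → ∃₂ λ x j → mp x ≡ v × ℓ v ≡ fin (suc j) × j < L × T (peel j x)
  ℓ-witness v ℓv≢∞ with minWhere-attained (λ y → ⌊ mp y ≟ v ⌋) ℓT (allFin m) ℓv≢∞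
  ... | x , mx≡v , ℓv≡ℓTx with ℓT x in ℓTx
  ...   | ∞     = ⊥-elim (ℓv≢∞ ℓv≡ℓTx)
  ...   | fin k with search-fin 0 L ℓTx
  ...     | j , refl , j<L , peel-j = x , j , toWitness mx≡v , ℓv≡ℓTx , j<L , peel-j

  missing-or-child : ∀ {x u} → T (adj G (mp x) u) →
    T (missing x u) ⊎ ∃ λ c → T (isChild tree x c) × mp c ≡ u
  missing-or-child {x} {u} adj-xu
    with any (λ c → isChild tree x c ∧ ⌊ mp c ≟ u ⌋) (allFin m)
       | any⁻ (λ c → isChild tree x c ∧ ⌊ mp c ≟ u ⌋) (allFin m)
  ... | false | _     = inj₁ (from T-∧ (adj-xu , _))
  ... | true  | found with satisfied (found _)
  ...   | c , child∧mc≡u with to T-∧ child∧mc≡u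
  ...     | child , mc≡u = inj₂ (c , child , toWitness mc≡u)

  high-neighbour-missing-or-child : ∀ {x j} → ℓ (mp x) ≡ fin (suc j) → j < L → ∀ u →
    T (adj G (mp x) u ∧ (ℓ (mp x) ≤∞ᵇ ℓ u)) →
    T (missing x u) ⊎ ∃ λ c → T (isChild tree x c ∧ geq j c) × mp c ≡ u
  high-neighbour-missing-or-child {x} {j} ℓx≡j+1 j<L u adj∧high with to T-∧ adj∧high
  ... | adj-xu , high with missing-or-child adj-xu
  ...   | inj₁ miss                = inj₁ miss
  ...   | inj₂ (c , child , mc≡u) = inj₂ (c , from T-∧ (child , ≤ℓT⇒geq j<L late) , mc≡u)
    where
    late : T (fin (suc j) ≤∞ᵇ ℓT c)
    late = ≤∞ᵇ-trans (fin (suc j)) (ℓ u) (ℓT c)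
             (subst (λ l → T (l ≤∞ᵇ ℓ u)) ℓx≡j+1 high) (ℓ-≤-ℓT mc≡u)

  count-high-neighbours-≤ : ∀ {x j} → ℓ (mp x) ≡ fin (suc j) → j < L → T (peel j x) →
    count (λ u → adj G (mp x) u ∧ (ℓ (mp x) ≤∞ᵇ ℓ u)) ≤ a
  count-high-neighbours-≤ {x} {j} ℓx≡j+1 j<L peel-j = begin
    count (λ u → adj G (mp x) u ∧ (ℓ (mp x) ≤∞ᵇ ℓ u))
      ≤⟨ count-≤-count+image mp (high-neighbour-missing-or-child ℓx≡j+1 j<L) ⟩
    count (missing x) + count children
      ≡⟨ +-comm (count (missing x)) (count children) ⟩
    count children + count (missing x)
      ≤⟨ ≤ᵇ⇒≤ _ a (proj₂ (to T-∧ peel-j)) ⟩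
    a
      ∎
    where
    open ≤-Reasoning
    children : Fin m → Bool
    children c = isChild tree x c ∧ geq j c

mainTheorem11 : ∀ {n m} (G : Graph n) (T : RootedTree m) (mp : Fin m → Fin n)
    → ValidMap G T mp → (a L : ℕ)
    → ∀ v → Layering.ℓ G T mp a L v ≢ ∞
    → count (λ u → adj G v u ∧ (Layering.ℓ G T mp a L v ≤∞ᵇ Layering.ℓ G T mp a L u)) ≤ a
mainTheorem11 G T mp _ a L v ℓv≢∞ with Peeling.ℓ-witness G T mp a L v ℓv≢∞
... | x , j , refl , ℓx≡j+1 , j<L , peel-j =
  Peeling.count-high-neighbours-≤ G T mp a L ℓx≡j+1 j<L peel-j
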